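{- Let $G=(V,E)$ be a finite simple undirected graph with vertex weights $p_i\ge 0$, let $K\geq2$, $Q\geq 1$ be integers, $L\le U$ reals, and let $\hat{\mathbf{x}}\in\mathcal{F}'_{HESS}$ be an integer feasible solution. Then the Integer $Q$-Connectivity Separation algorithm described below, run on $(G,\hat{\mathbf{x}},Q)$, adds violated separator constraints if and only if $\hat{\mathbf{x}}$ is not $Q$-proper.
   Context: $\mathcal{F}_{HESS}$ is the set of $\mathbf{x}\in\{0,1\}^{V\times V}$ with $L x_{ii}\le\sum_j p_j x_{ij}\le U x_{ii}$ ($\forall i$), $\sum_i x_{ii}=K$, $\sum_i x_{ij}=1$ ($\forall j$), $x_{ij}\le x_{ii}$ ($\forall i,j$). $\mathcal{F}'_{HESS}$ is the subset of $\mathcal{F}_{HESS}$ also satisfying $\sum_{j\in N(\{i\})}x_{rj}\geq Q x_{ri}$ for all $i,r\in V$, where $N(S)=\{v\in V\setminus S:\exists u\in S,(u,v)\in E\}$. Let $R(\hat{\mathbf{x}})=\{i:\hat x_{ii}=1\}$ (roots) and $V_r=\{i:\hat x_{ri}=1\}$. A graph with $n$ vertices is $Q$-connected if $n\ge Q+1$ and every vertex set whose removal disconnects it has size $\ge Q$; $\hat{\mathbf{x}}$ is $Q$-proper if $G[V_r]$ is $Q$-connected for all $r\in R(\hat{\mathbf{x}})$. For $a,b\in V$, an $a,b$-separator in $G$ is $C\subseteq V\setminus\{a,b\}$ with no $a,b$-path in $G-C$; $\mathcal{C}_{a,b,G}$ is the set of these. The separator constraints are $\sum_{c\in C}x_{rc}\ge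 Q x_{ra}x_{rb}$ for $a\ne b$, $r\in V$, $C\in\mathcal{C}_{a,b,G}$, together with their linearization via $y^r_{ab}=x_{ra}x_{rb}$ and $y^r_{ab}\le x_{ra}$, $y^r_{ab}\le x_{rb}$, $y^r_{ab}\ge x_{ra}+x_{rb}-1$; a violated separator constraint is a constraint implied by this family that $\hat{\mathbf{x}}$ violates. Procedure MinimalSeparator$(G,S,a,b)$ (with $b\in S$, $a\notin S$): let $\mathcal{N}=N(S)$; delete from $G$ all edges with both ends in $S\cup N(S)$; let $\mathcal{R}$ be the set of vertices reachable from $a$ in the resulting graph; return $\mathcal{N}\cap\mathcal{R}$. Algorithm (Integer $Q$-Connectivity Separation): for each $r\in R(\hat{\mathbf{x}})$: (1) for every connected component $G_0$ of $G[V_r]$ not containing $r$, pick an arbitrary vertex $b$ of $G_0$, let $C=$ MinimalSeparator$(G,V[G_0],r,b)$, and add the constraint $Q x_{rb}\le\sum_{c\in C}x_{rc}$. (2) Let $G_r$ be the component of $G[V_r]$ containing $r$ and let $D$ be a minimum cutset of $G_r$ (if $G_r$ is complete, $D$ is defined as $V[G_r]\setminus\{r\}$). If $|D|<Q$: if $r\notin D$, then for every component $G_0$ of $G_r-D$ not containing $r$, pick arbitrary $b\in V[G_0]$, let $C=$ MinimalSeparator$(G,V[G_0],r,b)$ and add $Q x_{rb}\le\sum_{c\in C}x_{rc}$; otherwise ($r\in D$), for every pair of components $G_1,G_2$ of $G_r-D$, pick arbitrary $a\in V[G_1]$, $b\in V[G_2]$, let $C=$ MinimalSeparator$(G,V[G_2],a,b)$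 and add $Q(x_{ra}+x_{rb}-1)\le\sum_{c\in C}x_{rc}$. -}

module Defs where

open import Level using (Level; suc; _⊔_)
open import Data.Nat using (ℕ; zero; _+_; _*_; _≤_; _<_)
open import Data.Fin using (Fin)
open import Data.Bool using (Bool; true; false; T; not; _∧_; _∨_; if_then_else_)
open import Data.List using (List; allFin; foldr; map)
open import Data.Bool.ListAction using (any)
open import Data.Product using (Σ; _×_; _,_; ∃; ∃-syntax)
open import Data.Sum using (_⊎_)
open import Relation.Nullary using (¬_)
open import Relation.Nullary.Decidable using (⌊_⌋)
open import Data.Fin using (_≟_)
open import Relation.Binary using (Rel; IsTotalOrder)
open import Relation.Binary.PropositionalEquality using (_≡_; _≢_)
open import Algebra.Bundles using (CommutativeRing)

-- Scalars for weights p and bounds L, U.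
-- The paper uses real numbers; agda-stdlib has no reals, so we work over
-- an arbitrary totally ordered commutative ring (ℝ is an instance).

record OrderedCommRing (c ℓ₁ ℓ₂ : Level) : Set (suc (c ⊔ ℓ₁ ⊔ ℓ₂)) where
  field
    ring : CommutativeRing c ℓ₁
  open CommutativeRing ring public
    using (Carrier; _≈_; 0#; 1#) renaming (_+_ to _+ᴿ_; _*_ to _*ᴿ_)
  field
    _≤ᴿ_        : Rel Carrier ℓ₂
    isTotalOrder : IsTotalOrder _≈_ _≤ᴿ_
    +-mono       : ∀ {a b} c → a ≤ᴿ b → (a +ᴿ c) ≤ᴿ (b +ᴿ c)
    *-nonneg     : ∀ {a b} → 0# ≤ᴿ a → 0# ≤ᴿ b → 0# ≤ᴿ (a *ᴿ b)

record Graph (n : ℕ) : Set where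
  field
    adj    : Fin n → Fin n → Bool
    sym    : ∀ u v → adj u v ≡ adj v u
    irrefl : ∀ u → adj u u ≡ false
open Graph public

VSet : ℕ → Set
VSet n = Fin n → Bool

_∈ₛ_ : ∀ {n} → Fin n → VSet n → Set
v ∈ₛ S = T (S v)

∅ₛ : ∀ {n} → VSet n
∅ₛ _ = false

_∩ₛ_ : ∀ {n} → VSet n → VSet n → VSet n
(S ∩ₛ S') v = S v ∧ S' v

_∪ₛ_ : ∀ {n} → VSet n → VSet n → VSet n
(S ∪ₛ S') v = S v ∨ S' v

_∖ₛ_ : ∀ {n} → VSet n → VSet n → VSet n
(S ∖ₛ S') v = S v ∧ not (S' v)

_⊆ₛ_ : ∀ {n} → VSet n → VSet n → Set
S ⊆ₛ S' = ∀ v → v ∈ₛ S → v ∈ₛ S'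

∣_∣ₛ : ∀ {n} → VSet n → ℕ
∣_∣ₛ {n} S = foldr _+_ 0 (map (λ v → if S v then 1 else 0) (allFin n))

N : ∀ {n} → Graph n → VSet n → VSet n
N {n} G S v = not (S v) ∧ any (λ u → S u ∧ adj G u v) (allFin n)

data PathIn {n} (G : Graph n) (W : VSet n) : Fin n → Fin n → Set where
  here : ∀ {u} → u ∈ₛ W → PathIn G W u u
  step : ∀ {u w v} → u ∈ₛ W → T (adj G u w) → PathIn G W w v → PathIn G W u v

Disconnected : ∀ {n} → Graph n → VSet n → Set
Disconnected G W = ∃[ u ] ∃[ v ] (u ∈ₛ W × v ∈ₛ W × ¬ PathIn G W u v)

Complete : ∀ {n} → Graph n → VSet n → Set
Complete G W = ∀ u v → u ∈ₛ W → v ∈ₛ W → u ≢ v → T (adj G u v)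

QConnected : ∀ {n} → Graph n → ℕ → VSet n → Set
QConnected G Q W =
  (Q + 1 ≤ ∣ W ∣ₛ) ×
  (∀ X → X ⊆ₛ W → Disconnected G (W ∖ₛ X) → Q ≤ ∣ X ∣ₛ)

IsSeparator : ∀ {n} → Graph n → Fin n → Fin n → VSet n → Set
IsSeparator G a b C =
  ¬ (a ∈ₛ C) × ¬ (b ∈ₛ C) × ¬ PathIn G (λ v → not (C v)) a b

-- Solutions x ∈ {0,1}^{V×V}; x r i = true means x_ri = 1.

Sol : ℕ → Set
Sol n = Fin n → Fin n → Bool

singleton : ∀ {n} → Fin n → VSet n
singleton i v = ⌊ v ≟ i ⌋

bit : Bool → ℕ
bit b = if b then 1 else 0

Σℕ : ∀ {n} → (Fin n → ℕ) → ℕ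
Σℕ {n} f = foldr _+_ 0 (map f (allFin n))

module _ {c ℓ₁ ℓ₂} (R : OrderedCommRing c ℓ₁ ℓ₂) where
  open OrderedCommRing R

  ΣR : ∀ {n} → (Fin n → Carrier) → Carrier
  ΣR {n} f = foldr _+ᴿ_ 0# (map f (allFin n))

  bitR : Bool → Carrier
  bitR b = if b then 1# else 0#

  InFHESS : ∀ {n} → (p : Fin n → Carrier) → Carrier → Carrier → ℕ → Sol n → Set ℓ₂
  InFHESS p L U K x =
    (∀ i → (L *ᴿ bitR (x i i)) ≤ᴿ ΣR (λ j → p j *ᴿ bitR (x i j))) ×
    (∀ i → ΣR (λ j → p j *ᴿ bitR (x i j)) ≤ᴿ (U *ᴿ bitR (x i i))) ×
    Lift′ (Σℕ (λ i → bit (x i i)) ≡ K) ×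
    Lift′ (∀ j → Σℕ (λ i → bit (x i j)) ≡ 1) ×
    Lift′ (∀ i j → T (x i j) → T (x i i))
    where
      Lift′ : Set → Set ℓ₂
      Lift′ A = Level.Lift ℓ₂ A

  InF'HESS : ∀ {n} → Graph n → (p : Fin n → Carrier) → Carrier → Carrier → ℕ → ℕ → Sol n → Set ℓ₂
  InF'HESS G p L U K Q x =
    InFHESS p L U K x ×
    Level.Lift ℓ₂ (∀ i r →
      Q * bit (x r i) ≤ Σℕ (λ j → bit (N G (singleton i) j ∧ x r j)))

Vr : ∀ {n} → Sol n → Fin n → VSet n
Vr x r = x r

IsRoot : ∀ {n} → Sol n → Fin n → Set
IsRoot x r = T (x r r)

QProper : ∀ {n} → Graph n → ℕ → Sol n → Set
QProper G Q x = ∀ r → IsRoot x r → QConnected G Q (Vr x r)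

-- Algorithmic (Bool-valued) reachability, as computed by the algorithm.
-- reachFrom A W a = set of vertices reachable from a in the graph with
-- vertex set W and adjacency A (breadth-first expansion iterated n times,
-- which reaches every vertex joined to a by a path).

expand : ∀ {n} → (Fin n → Fin n → Bool) → VSet n → VSet n → VSet n
expand {n} A W S v = S v ∨ (W v ∧ any (λ u → S u ∧ A u v) (allFin n))

iter : ∀ {n} → ℕ → (Fin n → Fin n → Bool) → VSet n → VSet n → VSet n
iter zero    A W S = S
iter (ℕ.suc k) A W S = iter k A W (expand A W S)

reachFrom : ∀ {n} → (Fin n → Fin n → Bool) → VSet n → Fin n → VSet n
reachFrom {n} A W a = iter n A W (singleton a ∩ₛ W)

comp : ∀ {n} → Graph n → VSet n → Fin n → VSet n
comp G W v = reachFrom (adj G) W v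

MinimalSeparator : ∀ {n} → Graph n → VSet n → Fin n → Fin n → VSet n
MinimalSeparator G S a b = N G S ∩ₛ reachFrom A' (λ _ → true) a
  where
    SN = S ∪ₛ N G S
    A' = λ u v → adj G u v ∧ not (SN u ∧ SN v)

data Constraint (n : ℕ) : Set where
  -- single r b C :   Q x_rb ≤ Σ_{c ∈ C} x_rc     (separator pair r, b)
  single : Fin n → Fin n → VSet n → Constraint n
  -- pair r a b C :   Q (x_ra + x_rb - 1) ≤ Σ_{c ∈ C} x_rc   (separator pair a, b)
  pair   : Fin n → Fin n → Fin n → VSet n → Constraint n

IsSeparatorConstraint : ∀ {n} → Graph n → Constraint n → Set
IsSeparatorConstraint G (single r b C)   = r ≢ b × IsSeparator G r b C
IsSeparatorConstraint G (pair r a b C)   = a ≢ b × IsSeparator G a b C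

ViolatedBy : ∀ {n} → ℕ → Sol n → Constraint n → Set
ViolatedBy Q x (single r b C) =
  Σℕ (λ c → bit (C c ∧ x r c)) < Q * bit (x r b)
ViolatedBy Q x (pair r a b C) =                    -- Σ < Q (x_ra + x_rb - 1)
  Σℕ (λ c → bit (C c ∧ x r c)) + Q < Q * (bit (x r a) + bit (x r b))

ViolatedSeparatorConstraint : ∀ {n} → Graph n → ℕ → Sol n → Constraint n → Set
ViolatedSeparatorConstraint G Q x c = IsSeparatorConstraint G c × ViolatedBy Q x c

Gr : ∀ {n} → Graph n → Sol n → Fin n → VSet n
Gr G x r = comp G (Vr x r) r

IsMinCutsetChoice : ∀ {n} → Graph n → VSet n → Fin n → VSet n → Set
IsMinCutsetChoice G W r D =
  (Complete G W → ∀ v → D v ≡ (W ∖ₛ singleton r) v) ×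
  (¬ Complete G W →
     D ⊆ₛ W × Disconnected G (W ∖ₛ D) ×
     (∀ X → X ⊆ₛ W → Disconnected G (W ∖ₛ X) → ∣ D ∣ₛ ≤ ∣ X ∣ₛ))

ExtSet : ∀ {n} → VSet n → VSet n → Set
ExtSet S S' = ∀ v → S v ≡ S' v

record Choices {n} (G : Graph n) (x : Sol n) : Set where
  field
    cut      : Fin n → VSet n
    cut-ok   : ∀ r → IsRoot x r → IsMinCutsetChoice G (Gr G x r) r (cut r)
    pick     : Fin n → VSet n → Fin n
    pick-∈   : ∀ r S v → v ∈ₛ S → pick r S ∈ₛ S
    pick-ext : ∀ r S S' → ExtSet S S' → pick r S ≡ pick r S'
    pick₂     : Fin n → VSet n → VSet n → Fin n × Fin n
    pick₂-∈   : ∀ r S₁ S₂ v₁ v₂ → v₁ ∈ₛ S₁ → v₂ ∈ₛ S₂ →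
                  (Data.Product.proj₁ (pick₂ r S₁ S₂) ∈ₛ S₁) ×
                  (Data.Product.proj₂ (pick₂ r S₁ S₂) ∈ₛ S₂)
    pick₂-ext : ∀ r S₁ S₁' S₂ S₂' → ExtSet S₁ S₁' → ExtSet S₂ S₂' →
                  pick₂ r S₁ S₂ ≡ pick₂ r S₁' S₂'

-- Components are given by a representative vertex v (vertex set comp W v).

module _ {n} (G : Graph n) (x : Sol n) (Q : ℕ) (ch : Choices G x) where
  open Choices ch

  data Adds : Constraint n → Set where
    step1 : ∀ r v → IsRoot x r → v ∈ₛ Vr x r →
            let S = comp G (Vr x r) v ; b = pick r S in
            ¬ (r ∈ₛ S) →
            Adds (single r b (MinimalSeparator G S r b))
    step2a : ∀ r v → IsRoot x r → ∣ cut r ∣ₛ < Q → ¬ (r ∈ₛ cut r) →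
             let W = Gr G x r ∖ₛ cut r ; S = comp G W v ; b = pick r S in
             v ∈ₛ W → ¬ (r ∈ₛ S) →
             Adds (single r b (MinimalSeparator G S r b))
    step2b : ∀ r v₁ v₂ → IsRoot x r → ∣ cut r ∣ₛ < Q → r ∈ₛ cut r →
             let W  = Gr G x r ∖ₛ cut r
                 S₁ = comp G W v₁ ; S₂ = comp G W v₂
                 a  = Data.Product.proj₁ (pick₂ r S₁ S₂)
                 b  = Data.Product.proj₂ (pick₂ r S₁ S₂) in
             v₁ ∈ₛ W → v₂ ∈ₛ W → ¬ (v₂ ∈ₛ S₁) →
             Adds (pair r a b (MinimalSeparator G S₂ a b))

{-# OPTIONS --safe #-}
-- Call a root r defective if V_r is not contained in the component G_r of r,
-- or if the chosen minimum cutset D of G_r has fewer than Q vertices.  Step (1)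
-- of the algorithm fires exactly at roots of the first kind and step (2) at
-- those of the second, and r is defective exactly when G[V_r] is not
-- Q-connected: the degree condition of F'_HESS gives |V_r| ≥ Q + 1 and forces
-- |D| ≥ Q when G_r is complete, so a small D is a genuine cutset of G_r = V_r.
-- Each added constraint is a separator constraint because, for a component S of
-- G[W] and a ∈ W outside S, a walk from a into S must pass through a vertex of
-- N(S) still reachable from a after deleting the edges inside S ∪ N(S); it is
-- violated because N(S) meets V_r only inside D (only inside ∅ in step (1)).
module Submission where

open import Defs
open import Level using (Level; lift)
open import Data.Nat using (ℕ; _≤_)
open import Data.Fin using (Fin)
open import Data.Product using (_×_; ∃)
open import Relation.Nullary using (¬_)
open import Function.Bundles using (_⇔_)

open import Data.Bool using (Bool; true; false; T; not; _∧_)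
open import Data.Bool.Properties using (T-∧; T-∨; ∧-comm)
open import Data.Bool.ListAction using (any)
open import Data.Empty using (⊥; ⊥-elim)
open import Data.Fin using (_≟_)
open import Data.Fin.Properties using (any?; all?; ¬∀⟶∃¬)
open import Data.List using (List; []; _∷_; allFin; map; length)
open import Data.Nat.ListAction using (sum)
open import Data.List.Membership.Propositional using (_∈_; lose)
open import Data.List.Membership.Propositional.Properties using (∈-allFin)
open import Data.List.Properties using (length-tabulate)
open import Data.List.Relation.Unary.Any as Any using (satisfied)
open import Data.List.Relation.Unary.Any.Properties using (any⁺; any⁻)
open import Data.Nat using (suc; zero; _+_; _*_; _<_; z≤n; s≤s; _<?_)
open import Data.Nat.Properties
  using (≤-trans; ≤-<-trans; +-mono-≤; +-mono-<-≤; +-mono-≤-<; +-monoˡ-<; +-comm;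
         *-identityʳ; *-distribˡ-+; <⇒≱; ≮⇒≥)
open import Data.Product using (_,_; proj₁; proj₂; map₂)
import Data.Sum as Sum
open import Data.Sum using (_⊎_; inj₁; inj₂; [_,_]′)
open import Function using (_∘_; id)
open import Function.Bundles using (Equivalence; mk⇔)
import Relation.Binary.PropositionalEquality as ≡
open ≡ using (_≡_; _≢_; refl; subst; cong; cong₂)
open import Relation.Nullary using (yes; no)
open import Relation.Nullary.Decidable
  using (T?; ¬?; _×-dec_; _⊎-dec_; _→-dec_; decidable-stable; toWitness; fromWitness)
open import Relation.Unary using (Decidable)

private
  variable
    n : ℕ
    G : Graph n
    S S' W W' X : VSet n
    a b r u v w : Fin n

T-not⁺ : ∀ {β} → ¬ T β → T (not β)
T-not⁺ {false} _   = _
T-not⁺ {true}  ¬tt = ¬tt _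

T-not⁻ : ∀ {β} → T (not β) → ¬ T β
T-not⁻ {false} _ ()

T-∧⁺ : ∀ {α β} → T α → T β → T (α ∧ β)
T-∧⁺ tα tβ = Equivalence.from T-∧ (tα , tβ)

T-∧⁻ : ∀ {α β} → T (α ∧ β) → T α × T β
T-∧⁻ = Equivalence.to T-∧

T-∧-not⁺ : ∀ {α β} → T α → ¬ T β → T (α ∧ not β)
T-∧-not⁺ tα ¬tβ = T-∧⁺ tα (T-not⁺ ¬tβ)

T-∧-not⁻ : ∀ {α β} → T (α ∧ not β) → T α × ¬ T β
T-∧-not⁻ h = map₂ T-not⁻ (T-∧⁻ h)

∖-monoˡ : S ⊆ₛ S' → (S ∖ₛ X) ⊆ₛ (S' ∖ₛ X)
∖-monoˡ S⊆S' v h = let (v∈S , v∉X) = T-∧-not⁻ h in T-∧-not⁺ (S⊆S' v v∈S) v∉X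

∈-singleton⁺ : a ∈ₛ singleton a
∈-singleton⁺ {a = a} = fromWitness {a? = a ≟ a} refl

∈-singleton⁻ : v ∈ₛ singleton a → v ≡ a
∈-singleton⁻ {v = v} {a = a} = toWitness {a? = v ≟ a}

∈⇒∈? : (S S' : VSet n) → Decidable (λ v → v ∈ₛ S → v ∈ₛ S')
∈⇒∈? S S' v = T? (S v) →-dec T? (S' v)

⊆ₛ-or-witness : (S S' : VSet n) → S ⊆ₛ S' ⊎ ∃ λ v → v ∈ₛ S × ¬ v ∈ₛ S'
⊆ₛ-or-witness {n} S S' with all? (∈⇒∈? S S')
... | yes S⊆S' = inj₁ S⊆S'
... | no  S⊈S' =
  let (v , ¬v∈S⇒v∈S') = ¬∀⟶∃¬ n _ (∈⇒∈? S S') S⊈S'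
  in inj₂ (v , decidable-stable (T? (S v)) (λ v∉S → ¬v∈S⇒v∈S' (⊥-elim ∘ v∉S))
             , λ v∈S' → ¬v∈S⇒v∈S' (λ _ → v∈S'))

any-allFin⁺ : (p : Fin n → Bool) → T (p u) → T (any p (allFin n))
any-allFin⁺ {u = u} p pu = any⁺ p (lose (∈-allFin u) pu)

any-allFin⁻ : (p : Fin n → Bool) → T (any p (allFin n)) → ∃ λ u → T (p u)
any-allFin⁻ {n} p h = satisfied (any⁻ p (allFin n) h)

∈-N⁺ : ¬ v ∈ₛ S → u ∈ₛ S → T (adj G u v) → v ∈ₛ N G S
∈-N⁺ {S = S} {G = G} v∉S u∈S e =
  T-∧⁺ (T-not⁺ v∉S) (any-allFin⁺ (λ u → S u ∧ adj G u _) (T-∧⁺ u∈S e))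

∈-N⁻ : v ∈ₛ N G S → ¬ v ∈ₛ S × ∃ λ u → u ∈ₛ S × T (adj G u v)
∈-N⁻ h =
  let (v∉S , adjacent) = T-∧⁻ h
      (u , u∈S∧e)      = any-allFin⁻ _ adjacent
  in T-not⁻ v∉S , u , T-∧⁻ u∈S∧e

bit-mono : ∀ {α β} → (T α → T β) → bit α ≤ bit β
bit-mono {false}         _   = z≤n
bit-mono {true}  {true}  _   = s≤s z≤n
bit-mono {true}  {false} α⇒β = ⊥-elim (α⇒β _)

bit-< : ∀ {α β} → ¬ T α → T β → bit α < bit β
bit-< {false} {true} _  _ = s≤s z≤n
bit-< {true}         ¬α _ = ⊥-elim (¬α _)

sum-map-mono : ∀ {A : Set} {f g : A → ℕ} → (∀ x → f x ≤ g x) →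
               ∀ xs → sum (map f xs) ≤ sum (map g xs)
sum-map-mono f≤g []       = z≤n
sum-map-mono f≤g (x ∷ xs) = +-mono-≤ (f≤g x) (sum-map-mono f≤g xs)

sum-map-strictMono : ∀ {A : Set} {f g : A → ℕ} → (∀ x → f x ≤ g x) →
                     ∀ {x xs} → x ∈ xs → f x < g x → sum (map f xs) < sum (map g xs)
sum-map-strictMono f≤g {xs = _ ∷ xs} (Any.here refl) fx<gx =
  +-mono-<-≤ fx<gx (sum-map-mono f≤g xs)
sum-map-strictMono f≤g {xs = y ∷ _} (Any.there x∈xs) fx<gx =
  +-mono-≤-< (f≤g y) (sum-map-strictMono f≤g x∈xs fx<gx)

sum-map-bit≤length : ∀ {A : Set} (f : A → Bool) xs → sum (map (bit ∘ f) xs) ≤ length xs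
sum-map-bit≤length f []       = z≤n
sum-map-bit≤length f (x ∷ xs) = +-mono-≤ (bit-mono {f x} {true} _) (sum-map-bit≤length f xs)

sum-map-zero : ∀ {A : Set} (xs : List A) → sum (map (λ _ → 0) xs) ≡ 0
sum-map-zero []       = refl
sum-map-zero (_ ∷ xs) = sum-map-zero xs

card-mono : S ⊆ₛ S' → ∣ S ∣ₛ ≤ ∣ S' ∣ₛ
card-mono {S = S} {S' = S'} S⊆S' =
  sum-map-mono {f = bit ∘ S} {g = bit ∘ S'} (λ v → bit-mono (S⊆S' v)) (allFin _)

card-strictMono : S ⊆ₛ S' → ¬ v ∈ₛ S → v ∈ₛ S' → ∣ S ∣ₛ < ∣ S' ∣ₛ
card-strictMono {S = S} {S' = S'} {v = v} S⊆S' v∉S v∈S' =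
  sum-map-strictMono {f = bit ∘ S} {g = bit ∘ S'}
    (λ u → bit-mono (S⊆S' u)) (∈-allFin v) (bit-< v∉S v∈S')

card≤n : (S : VSet n) → ∣ S ∣ₛ ≤ n
card≤n {n} S = subst (∣ S ∣ₛ ≤_) (length-tabulate id) (sum-map-bit≤length S (allFin n))

card-∅ : ∣ ∅ₛ {n} ∣ₛ ≡ 0
card-∅ {n} = sum-map-zero (allFin n)

adj-sym : (G : Graph n) → ∀ {u v} → T (adj G u v) → T (adj G v u)
adj-sym G {u} {v} = subst T (sym G u v)

PathIn-start : PathIn G W u v → u ∈ₛ W
PathIn-start (here u∈W)     = u∈W
PathIn-start (step u∈W _ _) = u∈W

PathIn-end : PathIn G W u v → v ∈ₛ W
PathIn-end (here v∈W)   = v∈W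
PathIn-end (step _ _ p) = PathIn-end p

PathIn-trans : PathIn G W u v → PathIn G W v w → PathIn G W u w
PathIn-trans (here _)       q = q
PathIn-trans (step u∈W e p) q = step u∈W e (PathIn-trans p q)

PathIn-sym : PathIn G W u v → PathIn G W v u
PathIn-sym {G = G} (here v∈W)     = here v∈W
PathIn-sym {G = G} (step u∈W e p) =
  PathIn-trans (PathIn-sym p) (step (PathIn-start p) (adj-sym G e) (here u∈W))

PathIn-mono : W ⊆ₛ W' → PathIn G W u v → PathIn G W' u v
PathIn-mono W⊆W' (here v∈W)     = here (W⊆W' _ v∈W)
PathIn-mono W⊆W' (step u∈W e p) = step (W⊆W' _ u∈W) e (PathIn-mono W⊆W' p)

Disconnected-≐ : W ⊆ₛ W' → W' ⊆ₛ W → Disconnected G W → Disconnected G W'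
Disconnected-≐ W⊆W' W'⊆W (u , v , u∈W , v∈W , ¬path) =
  u , v , W⊆W' u u∈W , W⊆W' v v∈W , ¬path ∘ PathIn-mono W'⊆W

complete⇒¬Disconnected : Complete G W → W' ⊆ₛ W → ¬ Disconnected G W'
complete⇒¬Disconnected cpl W'⊆W (u , v , u∈W' , v∈W' , ¬path) with u ≟ v
... | yes refl = ¬path (here u∈W')
... | no  u≢v  =
  ¬path (step u∈W' (cpl u v (W'⊆W u u∈W') (W'⊆W v v∈W') u≢v) (here v∈W'))

module Reachability (G : Graph n) (W : VSet n) where

  E : VSet n → VSet n
  E = expand (adj G) W

  ∈-E⁺ˡ : ∀ {S v} → v ∈ₛ S → v ∈ₛ E S
  ∈-E⁺ˡ v∈S = Equivalence.from T-∨ (inj₁ v∈S)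

  ∈-E⁺ʳ : ∀ {S u v} → v ∈ₛ W → u ∈ₛ S → T (adj G u v) → v ∈ₛ E S
  ∈-E⁺ʳ {S} v∈W u∈S e =
    Equivalence.from T-∨
      (inj₂ (T-∧⁺ v∈W (any-allFin⁺ (λ u → S u ∧ adj G u _) (T-∧⁺ u∈S e))))

  ∈-E⁻ : ∀ {S v} → v ∈ₛ E S →
         v ∈ₛ S ⊎ (v ∈ₛ W × ∃ λ u → u ∈ₛ S × T (adj G u v))
  ∈-E⁻ h = Sum.map₂ neighbour (Equivalence.to T-∨ h)
    where
      neighbour = λ h′ →
        let (v∈W , adjacent) = T-∧⁻ h′
            (u , u∈S∧e)      = any-allFin⁻ _ adjacent
        in v∈W , u , T-∧⁻ u∈S∧e

  Fixed : VSet n → Set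
  Fixed S = E S ⊆ₛ S

  E-inflationary : S ⊆ₛ E S
  E-inflationary {S = S} _ = ∈-E⁺ˡ {S}

  E-mono : S ⊆ₛ S' → E S ⊆ₛ E S'
  E-mono {S = S} {S' = S'} S⊆S' v h with ∈-E⁻ {S} h
  ... | inj₁ v∈S                 = ∈-E⁺ˡ {S'} (S⊆S' v v∈S)
  ... | inj₂ (v∈W , u , u∈S , e) = ∈-E⁺ʳ {S'} v∈W (S⊆S' u u∈S) e

  iter-suc : ∀ k S → iter (suc k) (adj G) W S ≡ E (iter k (adj G) W S)
  iter-suc zero    S = refl
  iter-suc (suc k) S = iter-suc k (E S)

  iter-inflationary : ∀ k S → S ⊆ₛ iter k (adj G) W S
  iter-inflationary zero    S _ v∈S = v∈S
  iter-inflationary (suc k) S v v∈S =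
    iter-inflationary k (E S) v (E-inflationary v v∈S)

  fixed-or-grows : ∀ S → Fixed S ⊎ ∣ S ∣ₛ < ∣ E S ∣ₛ
  fixed-or-grows S with ⊆ₛ-or-witness (E S) S
  ... | inj₁ fixed              = inj₁ fixed
  ... | inj₂ (v , v∈ES , v∉S) = inj₂ (card-strictMono E-inflationary v∉S v∈ES)

  -- Each round before a fixed point adds a vertex, so n rounds reach a fixed point.
  iter-fixed-or-grows : ∀ k S →
                        Fixed (iter k (adj G) W S) ⊎ k < ∣ iter (suc k) (adj G) W S ∣ₛ
  iter-fixed-or-grows zero    S = Sum.map₂ (≤-<-trans z≤n) (fixed-or-grows S)
  iter-fixed-or-grows (suc k) S with iter-fixed-or-grows k S
  ... | inj₁ fixed = inj₁ (subst Fixed (≡.sym (iter-suc k S)) (E-mono fixed))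
  ... | inj₂ k<    with fixed-or-grows (iter (suc k) (adj G) W S)
  ...   | inj₁ fixed = inj₁ fixed
  ...   | inj₂ grows =
    inj₂ (subst (λ Y → suc k < ∣ Y ∣ₛ) (≡.sym (iter-suc (suc k) S)) (≤-<-trans k< grows))

  iter-n-fixed : ∀ S → Fixed (iter n (adj G) W S)
  iter-n-fixed S with iter-fixed-or-grows n S
  ... | inj₁ fixed = fixed
  ... | inj₂ n<    = ⊥-elim (<⇒≱ n< (card≤n _))

  PathsFrom : Fin n → VSet n → Set
  PathsFrom a S = ∀ v → v ∈ₛ S → PathIn G W a v

  E-PathsFrom : PathsFrom a S → PathsFrom a (E S)
  E-PathsFrom {S = S} paths v h with ∈-E⁻ {S} h
  ... | inj₁ v∈S                 = paths v v∈S
  ... | inj₂ (v∈W , u , u∈S , e) =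
    PathIn-trans (paths u u∈S) (step (PathIn-end (paths u u∈S)) e (here v∈W))

  iter-PathsFrom : ∀ k S → PathsFrom a S → PathsFrom a (iter k (adj G) W S)
  iter-PathsFrom zero    S paths = paths
  iter-PathsFrom (suc k) S paths = iter-PathsFrom k (E S) (E-PathsFrom paths)

  reachFrom-sound : v ∈ₛ reachFrom (adj G) W a → PathIn G W a v
  reachFrom-sound {a = a} = iter-PathsFrom n (singleton a ∩ₛ W) start _
    where
      start : PathsFrom a (singleton a ∩ₛ W)
      start v h = let (v≡a , v∈W) = T-∧⁻ h in
                  subst (λ z → PathIn G W z v) (∈-singleton⁻ v≡a) (here v∈W)

  reachFrom-closed : u ∈ₛ reachFrom (adj G) W a → T (adj G u v) → v ∈ₛ W →
                     v ∈ₛ reachFrom (adj G) W a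
  reachFrom-closed {a = a} u∈R e v∈W =
    iter-n-fixed start _ (∈-E⁺ʳ {iter n (adj G) W start} v∈W u∈R e)
    where start = singleton a ∩ₛ W

  reachFrom-complete : PathIn G W a v → v ∈ₛ reachFrom (adj G) W a
  reachFrom-complete {a = a} p =
    extend p (iter-inflationary n _ a (T-∧⁺ ∈-singleton⁺ (PathIn-start p)))
    where
      extend : PathIn G W u v → u ∈ₛ reachFrom (adj G) W a → v ∈ₛ reachFrom (adj G) W a
      extend (here _)     u∈R = u∈R
      extend (step _ e p) u∈R = extend p (reachFrom-closed u∈R e (PathIn-start p))

module _ (G : Graph n) where

  comp-sound : u ∈ₛ comp G W v → PathIn G W v u
  comp-sound {W = W} = Reachability.reachFrom-sound G W

  comp-complete : PathIn G W v u → u ∈ₛ comp G W v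
  comp-complete {W = W} = Reachability.reachFrom-complete G W

  comp-closed : u ∈ₛ comp G W v → T (adj G u w) → w ∈ₛ W → w ∈ₛ comp G W v
  comp-closed {W = W} = Reachability.reachFrom-closed G W

  comp-self : v ∈ₛ W → v ∈ₛ comp G W v
  comp-self v∈W = comp-complete (here v∈W)

  comp-⊆ : comp G W v ⊆ₛ W
  comp-⊆ _ u∈S = PathIn-end (comp-sound u∈S)

  comp-sym : u ∈ₛ comp G W v → v ∈ₛ comp G W u
  comp-sym u∈S = comp-complete (PathIn-sym (comp-sound u∈S))

  comp-join : u ∈ₛ comp G W v → u ∈ₛ comp G W w → w ∈ₛ comp G W v
  comp-join u∈Sv u∈Sw =
    comp-complete (PathIn-trans (comp-sound u∈Sv) (PathIn-sym (comp-sound u∈Sw)))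

  N-comp-∉ : w ∈ₛ N G (comp G W v) → ¬ w ∈ₛ W
  N-comp-∉ w∈N w∈W =
    let (w∉S , u , u∈S , e) = ∈-N⁻ {G = G} w∈N in w∉S (comp-closed u∈S e w∈W)

  N-comp-∖-⊆ : (D : VSet n) → (N G (comp G (comp G W r ∖ₛ D) v) ∩ₛ W) ⊆ₛ D
  N-comp-∖-⊆ D c h with T? (D c)
  ... | yes c∈D = c∈D
  ... | no  c∉D =
    let (c∈N , c∈W)       = T-∧⁻ h
        (_ , u , u∈S , e) = ∈-N⁻ {G = G} c∈N
        u∈Gr              = proj₁ (T-∧-not⁻ (comp-⊆ u u∈S))
    in ⊥-elim (N-comp-∉ c∈N (T-∧-not⁺ (comp-closed u∈Gr e c∈W) c∉D))

  N-singleton-∩-⊆ : r ∈ₛ W → (N G (singleton r) ∩ₛ W) ⊆ₛ (comp G W r ∖ₛ singleton r)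
  N-singleton-∩-⊆ r∈W j h =
    let (j∈N , j∈W)         = T-∧⁻ h
        (j∉r , u , u∈r , e) = ∈-N⁻ {G = G} j∈N
        r~j                 = subst (λ z → T (adj G z j)) (∈-singleton⁻ u∈r) e
    in T-∧-not⁺ (comp-closed (comp-self r∈W) r~j j∈W) j∉r

  QConnected⇒⊆comp : ∀ {Q} → 1 ≤ Q → QConnected G Q W → r ∈ₛ W → W ⊆ₛ comp G W r
  QConnected⇒⊆comp {W = W} {r = r} {Q = Q} 1≤Q (_ , cuts) r∈W v v∈W =
    decidable-stable (T? (comp G W r v)) λ v∉Gr →
      <⇒≱ 1≤Q (subst (Q ≤_) (card-∅ {n}) (cuts ∅ₛ (λ _ ()) (W∖∅-disconnected v∉Gr)))
    where
      W∖∅-disconnected : ¬ v ∈ₛ comp G W r → Disconnected G (W ∖ₛ ∅ₛ)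
      W∖∅-disconnected v∉Gr = r , v , T-∧-not⁺ r∈W id , T-∧-not⁺ v∈W id ,
        λ p → v∉Gr (comp-complete (PathIn-mono (λ _ → proj₁ ∘ T-∧-not⁻) p))

deleteEdgesWithin : Graph n → VSet n → Graph n
deleteEdgesWithin G X = record
  { adj    = λ u v → adj G u v ∧ not (X u ∧ X v)
  ; sym    = λ u v → cong₂ (λ e f → e ∧ not f) (sym G u v) (∧-comm (X u) (X v))
  ; irrefl = λ u → cong (_∧ not (X u ∧ X u)) (irrefl G u)
  }

adj-deleteEdgesWithin⁺ : (G : Graph n) (X : VSet n) → T (adj G u v) → ¬ u ∈ₛ X →
                         T (adj (deleteEdgesWithin G X) u v)
adj-deleteEdgesWithin⁺ G X e u∉X = T-∧⁺ e (T-not⁺ (u∉X ∘ proj₁ ∘ T-∧⁻))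

module _ (G : Graph n) (S : VSet n) (a b : Fin n) where

  minimalSeparator-⊆-N : MinimalSeparator G S a b ⊆ₛ N G S
  minimalSeparator-⊆-N _ = proj₁ ∘ T-∧⁻

  -- Along a walk avoiding the separator, every vertex outside S stays reachable
  -- from a without edges inside S ∪ N(S); a step into S would leave from N(S).
  minimalSeparator-separates : ¬ a ∈ₛ S → b ∈ₛ S →
                               ¬ PathIn G (λ v → not (MinimalSeparator G S a b v)) a b
  minimalSeparator-separates a∉S b∈S p = escape p (comp-self H {W = λ _ → true} _) a∉S
    where
      H = deleteEdgesWithin G (S ∪ₛ N G S)

      escape : PathIn G (λ v → not (MinimalSeparator G S a b v)) u b →
               u ∈ₛ comp H (λ _ → true) a → ¬ u ∈ₛ S → ⊥
      escape (here _)         _   b∉S = b∉S b∈S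
      escape (step u∉C u~w p) u∈R u∉S = escape p (comp-closed H u∈R u~w′ _) w∉S
        where
          u∉N  = λ u∈N → T-not⁻ u∉C (T-∧⁺ u∈N u∈R)
          u~w′ = adj-deleteEdgesWithin⁺ G (S ∪ₛ N G S) u~w
                   ([ u∉S , u∉N ]′ ∘ Equivalence.to T-∨)
          w∉S  = λ w∈S → u∉N (∈-N⁺ {G = G} u∉S w∈S (adj-sym G u~w))

comp-separator : (G : Graph n) → a ∈ₛ W → ¬ a ∈ₛ comp G W v → b ∈ₛ comp G W v →
                 a ≢ b × IsSeparator G a b (MinimalSeparator G (comp G W v) a b)
comp-separator {a = a} {W = W} {v = v} {b = b} G a∈W a∉S b∈S =
  (λ { refl → a∉S b∈S }) ,
  (λ a∈C → N-comp-∉ G (minimalSeparator-⊆-N G (comp G W v) a b a a∈C) a∈W) ,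
  (λ b∈C → proj₁ (∈-N⁻ {G = G} (minimalSeparator-⊆-N G (comp G W v) a b b b∈C)) b∈S) ,
  minimalSeparator-separates G (comp G W v) a b a∉S b∈S

Q*bit≡Q : ∀ Q {β} → T β → Q * bit β ≡ Q
Q*bit≡Q Q {true} _ = *-identityʳ Q

module Algorithm (G : Graph n) (x : Sol n) (Q : ℕ) (ch : Choices G x) (1≤Q : 1 ≤ Q) where
  open Choices ch

  violated-single : ∀ {r b C} → T (x r b) → ∣ C ∩ₛ x r ∣ₛ < Q →
                    ViolatedBy Q x (single r b C)
  violated-single {r} {b} {C} b∈V load<Q =
    subst (∣ C ∩ₛ x r ∣ₛ <_) (≡.sym (Q*bit≡Q Q b∈V)) load<Q

  violated-pair : ∀ {r a b C} → T (x r a) → T (x r b) → ∣ C ∩ₛ x r ∣ₛ < Q →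
                  ViolatedBy Q x (pair r a b C)
  violated-pair {r} {a} {b} {C} a∈V b∈V load<Q =
    subst (∣ C ∩ₛ x r ∣ₛ + Q <_) (≡.sym Q[a+b]≡Q+Q) (+-monoˡ-< Q load<Q)
    where
      Q[a+b]≡Q+Q : Q * (bit (x r a) + bit (x r b)) ≡ Q + Q
      Q[a+b]≡Q+Q = ≡.trans (*-distribˡ-+ Q (bit (x r a)) (bit (x r b)))
                           (cong₂ _+_ (Q*bit≡Q Q a∈V) (Q*bit≡Q Q b∈V))

  separator-load<Q : ∀ r S a b D → (N G S ∩ₛ x r) ⊆ₛ D → ∣ D ∣ₛ < Q →
                     ∣ MinimalSeparator G S a b ∩ₛ x r ∣ₛ < Q
  separator-load<Q r S a b D N∩V⊆D ∣D∣<Q = ≤-<-trans (card-mono C∩V⊆D) ∣D∣<Q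
    where
      C∩V⊆D : (MinimalSeparator G S a b ∩ₛ _) ⊆ₛ D
      C∩V⊆D c h = let (c∈C , c∈V) = T-∧⁻ h in
                  N∩V⊆D c (T-∧⁺ (minimalSeparator-⊆-N G S a b c c∈C) c∈V)

  Gr∖cut⊆V : ∀ r → (Gr G x r ∖ₛ cut r) ⊆ₛ x r
  Gr∖cut⊆V r v h = comp-⊆ G v (proj₁ (T-∧-not⁻ h))

  adds⇒violated : ∀ {c} → Adds G x Q ch c → ViolatedSeparatorConstraint G Q x c
  adds⇒violated (step1 r v root v∈V r∉G₀) =
    comp-separator G root r∉G₀ b∈G₀ ,
    violated-single (comp-⊆ G _ b∈G₀)
      (separator-load<Q r G₀ r (pick r G₀) ∅ₛ N∩V⊆∅ ∣∅∣<Q)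
    where
      G₀   = comp G (x r) v
      b∈G₀ = pick-∈ r G₀ v (comp-self G v∈V)
      ∣∅∣<Q = subst (_< Q) (≡.sym (card-∅ {n})) 1≤Q
      N∩V⊆∅ : (N G G₀ ∩ₛ x r) ⊆ₛ ∅ₛ
      N∩V⊆∅ c h = let (c∈N , c∈V) = T-∧⁻ h in N-comp-∉ G c∈N c∈V
  adds⇒violated (step2a r v root ∣D∣<Q r∉D v∈Wr r∉G₀) =
    comp-separator G (T-∧-not⁺ (comp-self G root) r∉D) r∉G₀ b∈G₀ ,
    violated-single (Gr∖cut⊆V r _ (comp-⊆ G _ b∈G₀))
      (separator-load<Q r G₀ r (pick r G₀) (cut r) (N-comp-∖-⊆ G (cut r)) ∣D∣<Q)
    where
      G₀   = comp G (Gr G x r ∖ₛ cut r) v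
      b∈G₀ = pick-∈ r G₀ v (comp-self G v∈Wr)
  adds⇒violated (step2b r v₁ v₂ root ∣D∣<Q r∈D v₁∈Wr v₂∈Wr v₂∉G₁) =
    comp-separator G (comp-⊆ G _ a∈G₁) (v₂∉G₁ ∘ comp-join G a∈G₁) b∈G₂ ,
    violated-pair (Gr∖cut⊆V r _ (comp-⊆ G _ a∈G₁)) (Gr∖cut⊆V r _ (comp-⊆ G _ b∈G₂))
      (separator-load<Q r G₂ (proj₁ (pick₂ r G₁ G₂)) (proj₂ (pick₂ r G₁ G₂)) (cut r)
        (N-comp-∖-⊆ G (cut r)) ∣D∣<Q)
    where
      Wr = Gr G x r ∖ₛ cut r
      G₁ = comp G Wr v₁
      G₂ = comp G Wr v₂
      a∈G₁×b∈G₂ = pick₂-∈ r G₁ G₂ v₁ v₂ (comp-self G v₁∈Wr) (comp-self G v₂∈Wr)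
      a∈G₁ = proj₁ a∈G₁×b∈G₂
      b∈G₂ = proj₂ a∈G₁×b∈G₂

  Defective : Fin n → Set
  Defective r = IsRoot x r × ((∃ λ v → v ∈ₛ x r × ¬ v ∈ₛ Gr G x r) ⊎ ∣ cut r ∣ₛ < Q)

  defective? : Decidable Defective
  defective? r =
    T? (x r r) ×-dec (any? (λ v → T? (x r v) ×-dec ¬? (T? (Gr G x r v))) ⊎-dec ∣ cut r ∣ₛ <? Q)

  adds⇒defective : ∀ {c} → Adds G x Q ch c → ∃ Defective
  adds⇒defective (step1 r v root v∈V r∉G₀)         =
    r , root , inj₁ (v , v∈V , r∉G₀ ∘ comp-sym G)
  adds⇒defective (step2a r _ root ∣D∣<Q _ _ _)     = r , root , inj₂ ∣D∣<Q
  adds⇒defective (step2b r _ _ root ∣D∣<Q _ _ _ _) = r , root , inj₂ ∣D∣<Q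

  module _ (degree : ∀ i r → Q * bit (x r i) ≤ ∣ N G (singleton i) ∩ₛ x r ∣ₛ) where

    root-degree : ∀ {r} → IsRoot x r → Q ≤ ∣ N G (singleton r) ∩ₛ x r ∣ₛ
    root-degree {r} root =
      subst (_≤ ∣ N G (singleton r) ∩ₛ x r ∣ₛ) (Q*bit≡Q Q root) (degree r r)

    district-size : ∀ {r} → IsRoot x r → Q + 1 ≤ ∣ x r ∣ₛ
    district-size {r} root =
      subst (_≤ ∣ x r ∣ₛ) (+-comm 1 Q) (≤-<-trans (root-degree root) ∣N∩V∣<∣V∣)
      where
        r∉N : ¬ r ∈ₛ N G (singleton r)
        r∉N r∈N = proj₁ (∈-N⁻ {G = G} r∈N) ∈-singleton⁺
        ∣N∩V∣<∣V∣ = card-strictMono {S = N G (singleton r) ∩ₛ x r} {S' = x r}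
                      (λ _ → proj₂ ∘ T-∧⁻) (r∉N ∘ proj₁ ∘ T-∧⁻) root

    -- If G_r is complete, then D = G_r ∖ {r} contains every neighbour of r in V_r.
    small-cut⇒¬complete : ∀ {r} → IsRoot x r → ∣ cut r ∣ₛ < Q → ¬ Complete G (Gr G x r)
    small-cut⇒¬complete {r} root ∣D∣<Q cpl =
      <⇒≱ ∣D∣<Q (≤-trans (root-degree root) (card-mono N∩V⊆D))
      where
        N∩V⊆D : (N G (singleton r) ∩ₛ x r) ⊆ₛ cut r
        N∩V⊆D j h = subst T (≡.sym (proj₁ (cut-ok r root) cpl j)) (N-singleton-∩-⊆ G root j h)

    defective⇒adds : ∀ {r} → Defective r → ∃ (Adds G x Q ch)
    defective⇒adds {r} (root , inj₁ (v , v∈V , v∉Gr)) =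
      _ , step1 r v root v∈V (v∉Gr ∘ comp-sym G)
    defective⇒adds {r} (root , inj₂ ∣D∣<Q)
      with proj₂ (cut-ok r root) (small-cut⇒¬complete root ∣D∣<Q)
    ... | _ , (u , v , u∈W , v∈W , ¬u~v) , _ with T? (cut r r)
    ...   | yes r∈D = _ , step2b r u v root ∣D∣<Q r∈D u∈W v∈W (¬u~v ∘ comp-sound G)
    ...   | no  r∉D
      with T? (comp G (Gr G x r ∖ₛ cut r) u r) | T? (comp G (Gr G x r ∖ₛ cut r) v r)
    ...     | no  r∉Gu | _        = _ , step2a r u root ∣D∣<Q r∉D u∈W r∉Gu
    ...     | yes _    | no  r∉Gv = _ , step2a r v root ∣D∣<Q r∉D v∈W r∉Gv
    ...     | yes r∈Gu | yes r∈Gv = ⊥-elim (¬u~v (comp-sound G (comp-join G r∈Gu r∈Gv)))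

    defective⇒¬QConnected : ∀ {r} → Defective r → ¬ QConnected G Q (x r)
    defective⇒¬QConnected (root , inj₁ (v , v∈V , v∉Gr)) qc =
      v∉Gr (QConnected⇒⊆comp G 1≤Q qc root v v∈V)
    defective⇒¬QConnected {r} (root , inj₂ ∣D∣<Q) qc =
      <⇒≱ ∣D∣<Q (proj₂ qc (cut r) (λ v → comp-⊆ G v ∘ D⊆Gr v) V∖D-disconnected)
      where
        V⊆Gr = QConnected⇒⊆comp G 1≤Q qc root
        D-ok = proj₂ (cut-ok r root) (small-cut⇒¬complete root ∣D∣<Q)
        D⊆Gr = proj₁ D-ok
        V∖D-disconnected =
          Disconnected-≐ (∖-monoˡ (comp-⊆ G)) (∖-monoˡ V⊆Gr) (proj₁ (proj₂ D-ok))

    ¬defective⇒QConnected : ∀ {r} → IsRoot x r → ¬ Defective r → QConnected G Q (x r)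
    ¬defective⇒QConnected {r} root ¬defective = district-size root , cuts
      where
        V⊆Gr : x r ⊆ₛ Gr G x r
        V⊆Gr v v∈V = decidable-stable (T? (Gr G x r v))
                       (λ v∉Gr → ¬defective (root , inj₁ (v , v∈V , v∉Gr)))

        Q≤∣D∣ : Q ≤ ∣ cut r ∣ₛ
        Q≤∣D∣ = ≮⇒≥ (λ ∣D∣<Q → ¬defective (root , inj₂ ∣D∣<Q))

        cuts : ∀ X → X ⊆ₛ x r → Disconnected G (x r ∖ₛ X) → Q ≤ ∣ X ∣ₛ
        cuts X X⊆V disconnected =
          ≤-trans Q≤∣D∣ (D-minimum X (λ v → V⊆Gr v ∘ X⊆V v) Gr∖X-disconnected)
          where
            ¬complete = λ cpl →
              complete⇒¬Disconnected cpl (λ v → V⊆Gr v ∘ proj₁ ∘ T-∧-not⁻) disconnected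
            D-minimum = proj₂ (proj₂ (proj₂ (cut-ok r root) ¬complete))
            Gr∖X-disconnected =
              Disconnected-≐ (∖-monoˡ V⊆Gr) (∖-monoˡ (comp-⊆ G)) disconnected

    ¬QProper⇒adds : ¬ QProper G Q x → ∃ (Adds G x Q ch)
    ¬QProper⇒adds ¬proper with any? defective?
    ... | yes (r , defective) = defective⇒adds defective
    ... | no  ¬defective      =
      ⊥-elim (¬proper λ r root → ¬defective⇒QConnected root (¬defective ∘ (r ,_)))

    defective⇒¬QProper : ∃ Defective → ¬ QProper G Q x
    defective⇒¬QProper (r , defective) proper =
      defective⇒¬QConnected defective (proper r (proj₁ defective))

theorem2 : ∀ {c ℓ₁ ℓ₂ : Level} (R : OrderedCommRing c ℓ₁ ℓ₂) {n : ℕ}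
    (G : Graph n) (p : Fin n → OrderedCommRing.Carrier R)
    (L U : OrderedCommRing.Carrier R) (K Q : ℕ) (x : Sol n) →
    (∀ i → OrderedCommRing._≤ᴿ_ R (OrderedCommRing.0# R) (p i)) →
    OrderedCommRing._≤ᴿ_ R L U →
    2 ≤ K → 1 ≤ Q →
    InF'HESS R G p L U K Q x →
    (ch : Choices G x) →
    (∀ c → Adds G x Q ch c → ViolatedSeparatorConstraint G Q x c) ×
    ((∃ λ c → Adds G x Q ch c) ⇔ (¬ QProper G Q x))
theorem2 R G p L U K Q x _ _ _ 1≤Q (_ , lift degree) ch =
  (λ _ → adds⇒violated) ,
  mk⇔ (λ (_ , adds) → defective⇒¬QProper degree (adds⇒defective adds))
      (¬QProper⇒adds degree)
  where open Algorithm G x Q ch 1≤Q
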